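{- Let $G=(V,E)$ be a finite simple undirected graph and $\{x,y\}\in E$. Let $G_{x,y}$ be the graph obtained by subdividing $\{x,y\}$. Then \[\operatorname{nlcw}(G)-2\le\operatorname{nlcw}(G_{x,y})\le\operatorname{nlcw}(G)+2\quad\text{and}\quad \operatorname{cw}(G)-2\le\operatorname{cw}(G_{x,y})\le\operatorname{cw}(G)+2.\]
   Context: Subdivision: $G_{x,y}$ has vertex set $V\cup\{z\}$ for a new vertex $z$ and edge set $(E\setminus\{\{x,y\}\})\cup\{\{x,z\},\{y,z\}\}$. Clique-width: for a positive integer $k$, $\mathrm{CW}_k$ is the smallest class of graphs whose vertices carry labels from $\{1,\dots,k\}$ that contains every single-vertex graph with any label and is closed under: disjoint union; relabeling $\rho_{a\to b}$ for $a\neq b$; and $\eta_{a,b}$ for $a\neq b$ (add all edges between vertices labeled $a$ and vertices labeled $b$). $\operatorname{cw}(G)$ is the least $k$ such that some labeling of $G$ lies in $\mathrm{CW}_k$. NLC-width: $\mathrm{NLC}_k$ is the smallest class of labeled graphs (labels in $\{1,\dots,k\}$) containing every single-vertex graph with any label and closed under: $G\times_S J$ for $S\subseteq\{1,\dots,k\}^2$ (disjoint union of vertex-disjoint $G$ and $J$ plus all edges $\{u,v\}$, $u\in V_G$, $v\in V_J$, $(\mathrm{lab}(u),\mathrm{lab}(v))\in S$); and $\circ_R$ for $R:\{1,\dots,k\}\to\{1,\dots,k\}$. $\operatorname{nlcw}(G)$ is the least $k$ such that some labeling of $G$ lies in $\mathrm{NLC}_k$. -}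

module Defs where

open import Data.Nat using (ℕ; zero; suc; _+_; _<_)
open import Data.Fin using (Fin; zero; suc; splitAt; _≟_)
open import Data.Bool using (Bool; true; false; _∧_; _∨_; not)
open import Data.Sum using (inj₁; inj₂)
open import Data.Product using (Σ; _×_; ∃-syntax)
open import Relation.Nullary using (¬_; ⌊_⌋)
open import Relation.Binary.PropositionalEquality using (_≡_; _≢_)
open import Function.Bundles using (_↔_; Inverse)

record Graph : Set where
  constructor mkGraph
  field
    n   : ℕ
    adj : Fin n → Fin n → Bool
open Graph public

record IsSimple (G : Graph) : Set where
  field
    sym     : ∀ u v → adj G u v ≡ adj G v u
    irrefl  : ∀ u → adj G u u ≡ false

_≅_ : Graph → Graph → Set
G ≅ H = Σ (Fin (n G) ↔ Fin (n H)) λ f →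
          ∀ u v → adj H (Inverse.to f u) (Inverse.to f v) ≡ adj G u v

_==_ : ∀ {m} → Fin m → Fin m → Bool
a == b = ⌊ a ≟ b ⌋

-- Subdivision of the edge {x,y}: new vertex z is `zero`, old vertex v is `suc v`.
subdivide : (G : Graph) → Fin (n G) → Fin (n G) → Graph
subdivide G x y = mkGraph (suc (n G)) A
  where
  A : Fin (suc (n G)) → Fin (suc (n G)) → Bool
  A zero    zero    = false
  A zero    (suc v) = (v == x) ∨ (v == y)
  A (suc u) zero    = (u == x) ∨ (u == y)
  A (suc u) (suc v) = adj G u v ∧ not (((u == x) ∧ (v == y)) ∨ ((u == y) ∧ (v == x)))

record LGraph (k : ℕ) : Set where
  constructor mkLGraph
  field
    size : ℕ
    ladj : Fin size → Fin size → Bool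
    lab  : Fin size → Fin k
open LGraph public

underlying : ∀ {k} → LGraph k → Graph
underlying H = mkGraph (size H) (ladj H)

single : ∀ {k} → Fin k → LGraph k
single a = mkLGraph 1 (λ _ _ → false) (λ _ → a)

-- Disjoint union with additional edges between the parts given by S (on label pairs).
-- Vertices of G come first (Fin m), then those of J (Fin n) inside Fin (m + n).
joinWith : ∀ {k} → (Fin k → Fin k → Bool) → LGraph k → LGraph k → LGraph k
joinWith {k} S G J = mkLGraph (size G + size J) A L
  where
  L : Fin (size G + size J) → Fin k
  L w with splitAt (size G) w
  ... | inj₁ u = lab G u
  ... | inj₂ v = lab J v
  A : Fin (size G + size J) → Fin (size G + size J) → Bool
  A w w' with splitAt (size G) w | splitAt (size G) w'
  ... | inj₁ u | inj₁ u' = ladj G u u'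
  ... | inj₂ v | inj₂ v' = ladj J v v'
  ... | inj₁ u | inj₂ v' = S (lab G u) (lab J v')
  ... | inj₂ v | inj₁ u' = S (lab G u') (lab J v)

_⊕_ : ∀ {k} → LGraph k → LGraph k → LGraph k
G ⊕ J = joinWith (λ _ _ → false) G J

relabelBy : ∀ {k} → (Fin k → Fin k) → LGraph k → LGraph k
relabelBy R G = mkLGraph (size G) (ladj G) (λ u → R (lab G u))

ρ : ∀ {k} → Fin k → Fin k → LGraph k → LGraph k
ρ a b = relabelBy (λ c → if' (c == a) b c)
  where
  if' : ∀ {A : Set} → Bool → A → A → A
  if' true  t _ = t
  if' false _ e = e

η : ∀ {k} → Fin k → Fin k → LGraph k → LGraph k
η a b G = mkLGraph (size G)
  (λ u v → ladj G u v ∨ (((lab G u == a) ∧ (lab G v == b)) ∨ ((lab G u == b) ∧ (lab G v == a))))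
  (lab G)

data CW (k : ℕ) : LGraph k → Set where
  cw-single  : (a : Fin k) → CW k (single a)
  cw-union   : ∀ {G J} → CW k G → CW k J → CW k (G ⊕ J)
  cw-relabel : ∀ {G} (a b : Fin k) → a ≢ b → CW k G → CW k (ρ a b G)
  cw-edges   : ∀ {G} (a b : Fin k) → a ≢ b → CW k G → CW k (η a b G)

data NLC (k : ℕ) : LGraph k → Set where
  nlc-single  : (a : Fin k) → NLC k (single a)
  nlc-join    : ∀ {G J} (S : Fin k → Fin k → Bool) → NLC k G → NLC k J → NLC k (joinWith S G J)
  nlc-relabel : ∀ {G} (R : Fin k → Fin k) → NLC k G → NLC k (relabelBy R G)

HasCW : ℕ → Graph → Set
HasCW k G = ∃[ H ] (CW k H × (underlying H ≅ G))

HasNLC : ℕ → Graph → Set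
HasNLC k G = ∃[ H ] (NLC k H × (underlying H ≅ G))

IsCW : Graph → ℕ → Set
IsCW G c = (0 < c) × HasCW c G × (∀ k → 0 < k → k < c → ¬ HasCW k G)

IsNLCW : Graph → ℕ → Set
IsNLCW G c = (0 < c) × HasNLC c G × (∀ k → 0 < k → k < c → ¬ HasNLC k G)

{-# OPTIONS --safe #-}
-- Give the ends x and y of the edge fresh labels 0 and 1 and shift all other labels by 2.
-- A width-k expression for a graph H then becomes, operation by operation, a width-(k+2)
-- expression for H in which the adjacency between x and y is set at will: an operation that
-- involves the label of x or y is simulated on 0 or 1, since the original labels of x and y
-- are constants of the expression.  With the edge removed and a new vertex joined to the
-- labels 0 and 1 this yields G_{x,y}; in clique-width the new vertex needs a label of its own,
-- freed by first merging two labels of H.  Conversely, deleting a vertex never increases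
-- either width, and deleting the subdivision vertex of G_{x,y} leaves G without the edge xy,
-- which the same relabelling, now setting the x–y adjacency to true, turns back into G.

module Submission where

open import Defs
open import Data.Nat using (ℕ; zero; suc; _+_; _≤_; _<_; s≤s; z≤n)
open import Data.Nat.Properties using (+-comm; ≰⇒>; _≤?_)
open import Data.Bool using (Bool; true; false; _∧_; _∨_; not; if_then_else_; T)
open import Data.Bool.Properties
  using (T-∧; ∨-identityʳ; ∨-comm; ∨-assoc; ∨-idem; ∧-comm; ∧-zeroʳ; ∧-identityʳ; if-eta)
open import Data.Bool.ListAction using (any)
open import Data.Unit using (tt)
open import Data.Empty using (⊥-elim)
open import Data.Maybe using (Maybe; just; nothing; _>>=_) renaming (map to mapₘ)
open import Data.List using (List; []; _∷_; cartesianProduct; allFin)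
open import Data.List.Relation.Unary.Any using (satisfied)
open import Data.List.Relation.Unary.Any.Properties using (any⁺; any⁻)
open import Data.List.Membership.Propositional using (lose)
open import Data.List.Membership.Propositional.Properties using (∈-cartesianProduct⁺; ∈-allFin)
open import Data.Fin using (Fin; zero; suc; splitAt; join; _↑ˡ_; _↑ʳ_; _≟_; punchIn)
open import Data.Fin.Properties
  using (splitAt-↑ˡ; splitAt-↑ʳ; join-splitAt; +↔⊎; ↑ˡ-injective; ↑ʳ-injective; suc-injective)
open import Data.Fin.Permutation using (lift₀; remove; punchIn-permute)
open import Data.Sum using (_⊎_; inj₁; inj₂; isInj₁; isInj₂) renaming (map to map⊎)
open import Data.Sum.Function.Propositional using (_⊎-↔_)
open import Data.Sum.Properties using (swap-↔)
open import Data.Product using (_×_; _,_; proj₁; proj₂; ∃-syntax)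
open import Relation.Nullary using (¬_; yes; no; contradiction)
open import Relation.Binary.PropositionalEquality
open import Function using (_∘_; flip; case_of_)
open import Function.Bundles using (_↔_; Inverse; Injection; Equivalence; mk↔ₛ′)
open import Function.Properties.Inverse using (↔-refl; ↔-sym; ↔-trans; ↔⇒↣)

open Inverse using (to; from; strictlyInverseˡ)

==-refl : ∀ {m} (u : Fin m) → (u == u) ≡ true
==-refl u with u ≟ u
... | yes _  = refl
... | no u≢u = contradiction refl u≢u

==-≢ : ∀ {m} {u v : Fin m} → u ≢ v → (u == v) ≡ false
==-≢ {u = u} {v} u≢v with u ≟ v
... | yes u≡v = contradiction u≡v u≢v
... | no _    = refl

==⇒≡ : ∀ {m} {u v : Fin m} → (u == v) ≡ true → u ≡ v
==⇒≡ {u = u} {v} eq with u ≟ v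
... | yes u≡v = u≡v

==-injective : ∀ {m n} (f : Fin m → Fin n) → (∀ {u v} → f u ≡ f v → u ≡ v) →
               ∀ u v → (f u == f v) ≡ (u == v)
==-injective f inj u v with u ≟ v
... | yes refl = ==-refl (f u)
... | no u≢v   = ==-≢ (u≢v ∘ inj)

==-to : ∀ {m m′} (e : Fin m ↔ Fin m′) u x → (to e u == x) ≡ (u == from e x)
==-to e u x = begin
  to e u == x             ≡⟨ cong (to e u ==_) (sym (strictlyInverseˡ e x)) ⟩
  to e u == to e (from e x) ≡⟨ ==-injective (to e) (Injection.injective (↔⇒↣ e)) u (from e x) ⟩
  u == from e x           ∎
  where open ≡-Reasoning

isPair : ∀ {m} → Fin m → Fin m → Fin m → Fin m → Bool
isPair a b u v = ((u == a) ∧ (v == b)) ∨ ((u == b) ∧ (v == a))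

isPair-self : ∀ {m} (a b : Fin m) → T (isPair a b a b)
isPair-self a b rewrite ==-refl a | ==-refl b = tt

isPair-sound : ∀ {m} {a b u v : Fin m} → T (isPair a b u v) → (u ≡ a × v ≡ b) ⊎ (u ≡ b × v ≡ a)
isPair-sound {a = a} {b} {u} {v} t with u ≟ a | v ≟ b | u ≟ b | v ≟ a
... | yes p | yes q | _     | _     = inj₁ (p , q)
... | _     | _     | yes p | yes q = inj₂ (p , q)
... | no _  | _     | no _  | _     = ⊥-elim t
... | no _  | _     | yes _ | no _  = ⊥-elim t
... | yes _ | no _  | no _  | _     = ⊥-elim t
... | yes _ | no _  | yes _ | no _  = ⊥-elim t

isPair-sym : ∀ {m} (a b u v : Fin m) → isPair a b u v ≡ isPair a b v u
isPair-sym a b u v = trans (∨-comm ((u == a) ∧ (v == b)) ((u == b) ∧ (v == a)))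
                           (cong₂ _∨_ (∧-comm (u == b) (v == a)) (∧-comm (u == a) (v == b)))

isPair-irrefl : ∀ {m} {a b : Fin m} → a ≢ b → ∀ u → isPair a b u u ≡ false
isPair-irrefl {a = a} {b} a≢b u with u ≟ a | u ≟ b
... | yes refl | yes refl = contradiction refl a≢b
... | yes _    | no _     = refl
... | no _     | yes _    = refl
... | no _     | no _     = refl

isPair-↔ : ∀ {m m′} (e : Fin m ↔ Fin m′) x y u v → isPair x y (to e u) (to e v) ≡ isPair (from e x) (from e y) u v
isPair-↔ e x y u v rewrite ==-to e u x | ==-to e u y | ==-to e v x | ==-to e v y = refl

T-ext : ∀ {x y} → (T x → T y) → (T y → T x) → x ≡ y
T-ext {false} {false} _ _ = refl
T-ext {false} {true}  _ g = ⊥-elim (g tt)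
T-ext {true}  {false} f _ = ⊥-elim (f tt)
T-ext {true}  {true}  _ _ = refl

data Split (m n : ℕ) : Fin (m + n) → Set where
  ↑ˡ-split : (u : Fin m) → Split m n (u ↑ˡ n)
  ↑ʳ-split : (v : Fin n) → Split m n (m ↑ʳ v)

split : ∀ m n (w : Fin (m + n)) → Split m n w
split m n w = subst (Split m n) (join-splitAt m n w) (view (splitAt m w))
  where
  view : (s : Fin m ⊎ Fin n) → Split m n (join m n s)
  view (inj₁ u) = ↑ˡ-split u
  view (inj₂ v) = ↑ʳ-split v

↑ˡ≢↑ʳ : ∀ m n (u : Fin m) (v : Fin n) → u ↑ˡ n ≢ m ↑ʳ v
↑ˡ≢↑ʳ m n u v eq with trans (sym (splitAt-↑ˡ m u n)) (trans (cong (splitAt m) eq) (splitAt-↑ʳ m n v))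
... | ()

+-map : ∀ {m m′ n n′} → (Fin m → Fin m′) → (Fin n → Fin n′) → Fin (m + n) → Fin (m′ + n′)
+-map {m} {m′} {n} {n′} f h w = join m′ n′ (map⊎ f h (splitAt m w))

module _ {m m′ n n′} (f : Fin m → Fin m′) (h : Fin n → Fin n′) where
  +-map-↑ˡ : ∀ u → +-map f h (u ↑ˡ n) ≡ f u ↑ˡ n′
  +-map-↑ˡ u rewrite splitAt-↑ˡ m u n = refl

  +-map-↑ʳ : ∀ v → +-map f h (m ↑ʳ v) ≡ m′ ↑ʳ h v
  +-map-↑ʳ v rewrite splitAt-↑ʳ m n v = refl

+-cong-↔ : ∀ {m m′ n n′} → Fin m ↔ Fin m′ → Fin n ↔ Fin n′ → Fin (m + n) ↔ Fin (m′ + n′)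
+-cong-↔ {m} {m′} {n} {n′} e₁ e₂ = ↔-trans (+↔⊎ {m} {n}) (↔-trans (e₁ ⊎-↔ e₂) (↔-sym (+↔⊎ {m′} {n′})))

+-comm-↔ : ∀ m n → Fin (m + n) ↔ Fin (n + m)
+-comm-↔ m n = ↔-trans (+↔⊎ {m} {n}) (↔-trans swap-↔ (↔-sym (+↔⊎ {n} {m})))

+-comm-↑ˡ : ∀ m n (u : Fin m) → to (+-comm-↔ m n) (u ↑ˡ n) ≡ n ↑ʳ u
+-comm-↑ˡ m n u rewrite splitAt-↑ˡ m u n = refl

+-comm-↑ʳ : ∀ m n (v : Fin n) → to (+-comm-↔ m n) (m ↑ʳ v) ≡ v ↑ˡ m
+-comm-↑ʳ m n v rewrite splitAt-↑ʳ m n v = refl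

module _ {k : ℕ} (S : Fin k → Fin k → Bool) (G J : LGraph k) where
  private
    g = size G
    j = size J

  joinWith-adjˡˡ : ∀ u u′ → ladj (joinWith S G J) (u ↑ˡ j) (u′ ↑ˡ j) ≡ ladj G u u′
  joinWith-adjˡˡ u u′ rewrite splitAt-↑ˡ g u j | splitAt-↑ˡ g u′ j = refl

  joinWith-adjˡʳ : ∀ u v → ladj (joinWith S G J) (u ↑ˡ j) (g ↑ʳ v) ≡ S (lab G u) (lab J v)
  joinWith-adjˡʳ u v rewrite splitAt-↑ˡ g u j | splitAt-↑ʳ g j v = refl

  joinWith-adjʳˡ : ∀ v u → ladj (joinWith S G J) (g ↑ʳ v) (u ↑ˡ j) ≡ S (lab G u) (lab J v)
  joinWith-adjʳˡ v u rewrite splitAt-↑ˡ g u j | splitAt-↑ʳ g j v = refl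

  joinWith-adjʳʳ : ∀ v v′ → ladj (joinWith S G J) (g ↑ʳ v) (g ↑ʳ v′) ≡ ladj J v v′
  joinWith-adjʳʳ v v′ rewrite splitAt-↑ʳ g j v | splitAt-↑ʳ g j v′ = refl

  joinWith-labˡ : ∀ u → lab (joinWith S G J) (u ↑ˡ j) ≡ lab G u
  joinWith-labˡ u rewrite splitAt-↑ˡ g u j = refl

  joinWith-labʳ : ∀ v → lab (joinWith S G J) (g ↑ʳ v) ≡ lab J v
  joinWith-labʳ v rewrite splitAt-↑ʳ g j v = refl

-- η a b H is definitionally ηRel (isPair a b) H.
ηRel : ∀ {k} → (Fin k → Fin k → Bool) → LGraph k → LGraph k
ηRel R H = mkLGraph (size H) (λ u v → ladj H u v ∨ R (lab H u) (lab H v)) (lab H)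

-- Defs provides ρ a b only as an operation on graphs; this is its action on labels,
-- so that ρ a b H is definitionally relabelBy (ρ-map a b) H.
ρ-map : ∀ {k} → Fin k → Fin k → Fin k → Fin k
ρ-map a b c = lab (ρ a b (single c)) zero

record IsEmbedding {k} (H′ H : LGraph k) (f : Fin (size H′) → Fin (size H)) : Set where
  field
    adj-pres : ∀ u v → ladj H (f u) (f v) ≡ ladj H′ u v
    lab-pres : ∀ u → lab H (f u) ≡ lab H′ u
open IsEmbedding

module _ {k : ℕ} where
  embedding-∘ : ∀ {H₁ H₂ H₃ : LGraph k} {f g} →
                IsEmbedding H₁ H₂ f → IsEmbedding H₂ H₃ g → IsEmbedding H₁ H₃ (g ∘ f)
  embedding-∘ φ ψ = record
    { adj-pres = λ u v → trans (adj-pres ψ _ _) (adj-pres φ u v)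
    ; lab-pres = λ u → trans (lab-pres ψ _) (lab-pres φ u)
    }

  embedding-cong : ∀ {H′ H : LGraph k} {f f′} → (∀ u → f u ≡ f′ u) → IsEmbedding H′ H f → IsEmbedding H′ H f′
  embedding-cong {H = H} f≗f′ φ = record
    { adj-pres = λ u v → trans (cong₂ (ladj H) (sym (f≗f′ u)) (sym (f≗f′ v))) (adj-pres φ u v)
    ; lab-pres = λ u → trans (cong (lab H) (sym (f≗f′ u))) (lab-pres φ u)
    }

  embedding-inverse : ∀ {H H′ : LGraph k} (e : Fin (size H) ↔ Fin (size H′)) →
                      IsEmbedding H H′ (to e) → IsEmbedding H′ H (from e)
  embedding-inverse {H′ = H′} e φ = record
    { adj-pres = λ u v → trans (sym (adj-pres φ _ _)) (cong₂ (ladj H′) (strictlyInverseˡ e u) (strictlyInverseˡ e v))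
    ; lab-pres = λ u → trans (sym (lab-pres φ _)) (cong (lab H′) (strictlyInverseˡ e u))
    }

  embedding-relabelBy : ∀ (R : Fin k → Fin k) {H′ H f} → IsEmbedding H′ H f → IsEmbedding (relabelBy R H′) (relabelBy R H) f
  embedding-relabelBy R φ = record { adj-pres = adj-pres φ ; lab-pres = λ u → cong R (lab-pres φ u) }

  embedding-ηRel : ∀ (R : Fin k → Fin k → Bool) {H′ H f} → IsEmbedding H′ H f → IsEmbedding (ηRel R H′) (ηRel R H) f
  embedding-ηRel R φ = record
    { adj-pres = λ u v → cong₂ _∨_ (adj-pres φ u v) (cong₂ R (lab-pres φ u) (lab-pres φ v))
    ; lab-pres = lab-pres φ
    }

  embedding-joinWith : ∀ (S : Fin k → Fin k → Bool) {G′ G J′ J f h} → IsEmbedding G′ G f → IsEmbedding J′ J h →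
                       IsEmbedding (joinWith S G′ J′) (joinWith S G J) (+-map f h)
  embedding-joinWith S {G′} {G} {J′} {J} {f} {h} φ ψ = record { adj-pres = adjs ; lab-pres = labs }
    where
    adjs : ∀ w w′ → ladj (joinWith S G J) (+-map f h w) (+-map f h w′) ≡ ladj (joinWith S G′ J′) w w′
    adjs w w′ with split (size G′) (size J′) w | split (size G′) (size J′) w′
    ... | ↑ˡ-split u | ↑ˡ-split u′ rewrite +-map-↑ˡ f h u | +-map-↑ˡ f h u′
      | joinWith-adjˡˡ S G J (f u) (f u′) | joinWith-adjˡˡ S G′ J′ u u′ = adj-pres φ u u′
    ... | ↑ˡ-split u | ↑ʳ-split v′ rewrite +-map-↑ˡ f h u | +-map-↑ʳ f h v′
      | joinWith-adjˡʳ S G J (f u) (h v′) | joinWith-adjˡʳ S G′ J′ u v′ = cong₂ S (lab-pres φ u) (lab-pres ψ v′)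
    ... | ↑ʳ-split v | ↑ˡ-split u′ rewrite +-map-↑ʳ f h v | +-map-↑ˡ f h u′
      | joinWith-adjʳˡ S G J (h v) (f u′) | joinWith-adjʳˡ S G′ J′ v u′ = cong₂ S (lab-pres φ u′) (lab-pres ψ v)
    ... | ↑ʳ-split v | ↑ʳ-split v′ rewrite +-map-↑ʳ f h v | +-map-↑ʳ f h v′
      | joinWith-adjʳʳ S G J (h v) (h v′) | joinWith-adjʳʳ S G′ J′ v v′ = adj-pres ψ v v′
    labs : ∀ w → lab (joinWith S G J) (+-map f h w) ≡ lab (joinWith S G′ J′) w
    labs w with split (size G′) (size J′) w
    ... | ↑ˡ-split u rewrite +-map-↑ˡ f h u | joinWith-labˡ S G J (f u) | joinWith-labˡ S G′ J′ u = lab-pres φ u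
    ... | ↑ʳ-split v rewrite +-map-↑ʳ f h v | joinWith-labʳ S G J (h v) | joinWith-labʳ S G′ J′ v = lab-pres ψ v

  embedding-joinWithʳ : ∀ (S : Fin k → Fin k → Bool) (G J : LGraph k) → IsEmbedding J (joinWith S G J) (size G ↑ʳ_)
  embedding-joinWithʳ S G J = record { adj-pres = joinWith-adjʳʳ S G J ; lab-pres = joinWith-labʳ S G J }

record _≃_ {k} (H H′ : LGraph k) : Set where
  field
    bij       : Fin (size H) ↔ Fin (size H′)
    embedding : IsEmbedding H H′ (to bij)
open _≃_

module _ {k : ℕ} where
  ≃-pointwise : ∀ {s} {A A′ : Fin s → Fin s → Bool} {L L′ : Fin s → Fin k} →
                (∀ u v → A′ u v ≡ A u v) → (∀ u → L′ u ≡ L u) → mkLGraph s A L ≃ mkLGraph s A′ L′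
  ≃-pointwise A′≗A L′≗L = record { bij = ↔-refl ; embedding = record { adj-pres = A′≗A ; lab-pres = L′≗L } }

  ≃-refl : ∀ {H : LGraph k} → H ≃ H
  ≃-refl = ≃-pointwise (λ _ _ → refl) (λ _ → refl)

  ≃-trans : ∀ {H₁ H₂ H₃ : LGraph k} → H₁ ≃ H₂ → H₂ ≃ H₃ → H₁ ≃ H₃
  ≃-trans φ ψ = record { bij = ↔-trans (bij φ) (bij ψ) ; embedding = embedding-∘ (embedding φ) (embedding ψ) }

  ≃-sym : ∀ {H H′ : LGraph k} → H ≃ H′ → H′ ≃ H
  ≃-sym φ = record { bij = ↔-sym (bij φ) ; embedding = embedding-inverse (bij φ) (embedding φ) }

  ≃-relabelBy : ∀ (R : Fin k → Fin k) {H H′} → H ≃ H′ → relabelBy R H ≃ relabelBy R H′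
  ≃-relabelBy R φ = record { bij = bij φ ; embedding = embedding-relabelBy R (embedding φ) }

  ≃-ηRel : ∀ (R : Fin k → Fin k → Bool) {H H′} → H ≃ H′ → ηRel R H ≃ ηRel R H′
  ≃-ηRel R φ = record { bij = bij φ ; embedding = embedding-ηRel R (embedding φ) }

  ≃-joinWith : ∀ (S : Fin k → Fin k → Bool) {G G′ J J′} →
               G ≃ G′ → J ≃ J′ → joinWith S G J ≃ joinWith S G′ J′
  ≃-joinWith S φ ψ = record { bij = +-cong-↔ (bij φ) (bij ψ) ; embedding = embedding-joinWith S (embedding φ) (embedding ψ) }

  ≃-ηRel-rel : ∀ {R R′ : Fin k → Fin k → Bool} (H : LGraph k) →
               (∀ l l′ → R l l′ ≡ R′ l l′) → ηRel R H ≃ ηRel R′ H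
  ≃-ηRel-rel H R≗R′ = ≃-pointwise (λ u v → cong (ladj H u v ∨_) (sym (R≗R′ (lab H u) (lab H v)))) (λ _ → refl)

  joinWith-swap : ∀ (S : Fin k → Fin k → Bool) (G J : LGraph k) → joinWith S G J ≃ joinWith (flip S) J G
  joinWith-swap S G J = record { bij = +-comm-↔ g j ; embedding = record { adj-pres = adjs ; lab-pres = labs } }
    where
    g = size G
    j = size J
    swp = to (+-comm-↔ g j)
    adjs : ∀ w w′ → ladj (joinWith (flip S) J G) (swp w) (swp w′) ≡ ladj (joinWith S G J) w w′
    adjs w w′ with split g j w | split g j w′
    ... | ↑ˡ-split u | ↑ˡ-split u′ rewrite +-comm-↑ˡ g j u | +-comm-↑ˡ g j u′
      | joinWith-adjʳʳ (flip S) J G u u′ | joinWith-adjˡˡ S G J u u′ = refl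
    ... | ↑ˡ-split u | ↑ʳ-split v′ rewrite +-comm-↑ˡ g j u | +-comm-↑ʳ g j v′
      | joinWith-adjʳˡ (flip S) J G u v′ | joinWith-adjˡʳ S G J u v′ = refl
    ... | ↑ʳ-split v | ↑ˡ-split u′ rewrite +-comm-↑ʳ g j v | +-comm-↑ˡ g j u′
      | joinWith-adjˡʳ (flip S) J G v u′ | joinWith-adjʳˡ S G J v u′ = refl
    ... | ↑ʳ-split v | ↑ʳ-split v′ rewrite +-comm-↑ʳ g j v | +-comm-↑ʳ g j v′
      | joinWith-adjˡˡ (flip S) J G v v′ | joinWith-adjʳʳ S G J v v′ = refl
    labs : ∀ w → lab (joinWith (flip S) J G) (swp w) ≡ lab (joinWith S G J) w
    labs w with split g j w
    ... | ↑ˡ-split u rewrite +-comm-↑ˡ g j u | joinWith-labʳ (flip S) J G u | joinWith-labˡ S G J u = refl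
    ... | ↑ʳ-split v rewrite +-comm-↑ʳ g j v | joinWith-labˡ (flip S) J G v | joinWith-labʳ S G J v = refl

≃-joinWith-rel : ∀ {k} {S S′ : Fin k → Fin k → Bool} (G J : LGraph k) →
                 (∀ l l′ → S l l′ ≡ S′ l l′) → joinWith S G J ≃ joinWith S′ G J
≃-joinWith-rel {S = S} {S′} G J S≗S′ = ≃-pointwise adjs labs
  where
  adjs : ∀ w w′ → ladj (joinWith S′ G J) w w′ ≡ ladj (joinWith S G J) w w′
  adjs w w′ with split (size G) (size J) w | split (size G) (size J) w′
  ... | ↑ˡ-split u | ↑ˡ-split u′ rewrite joinWith-adjˡˡ S′ G J u u′ | joinWith-adjˡˡ S G J u u′ = refl
  ... | ↑ˡ-split u | ↑ʳ-split v′ rewrite joinWith-adjˡʳ S′ G J u v′ | joinWith-adjˡʳ S G J u v′ = sym (S≗S′ _ _)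
  ... | ↑ʳ-split v | ↑ˡ-split u′ rewrite joinWith-adjʳˡ S′ G J v u′ | joinWith-adjʳˡ S G J v u′ = sym (S≗S′ _ _)
  ... | ↑ʳ-split v | ↑ʳ-split v′ rewrite joinWith-adjʳʳ S′ G J v v′ | joinWith-adjʳʳ S G J v v′ = refl
  labs : ∀ w → lab (joinWith S′ G J) w ≡ lab (joinWith S G J) w
  labs w with split (size G) (size J) w
  ... | ↑ˡ-split u rewrite joinWith-labˡ S′ G J u | joinWith-labˡ S G J u = refl
  ... | ↑ʳ-split v rewrite joinWith-labʳ S′ G J v | joinWith-labʳ S G J v = refl

UpTo≃ : ∀ {k} → (LGraph k → Set) → LGraph k → Set
UpTo≃ C H = ∃[ H₀ ] (C H₀ × H₀ ≃ H)

Has : ∀ {k} → (LGraph k → Set) → Graph → Set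
Has C G = ∃[ H ] (C H × underlying H ≅ G)

module _ {k : ℕ} {C : LGraph k → Set} where
  upTo≃-of : ∀ {H} → C H → UpTo≃ C H
  upTo≃-of c = _ , c , ≃-refl

  upTo≃-≃ : ∀ {H H′} → UpTo≃ C H → H ≃ H′ → UpTo≃ C H′
  upTo≃-≃ (H₀ , c , φ) ψ = H₀ , c , ≃-trans φ ψ

  upTo≃-map : (F : LGraph k → LGraph k) → (∀ {H} → C H → C (F H)) → (∀ {H H′} → H ≃ H′ → F H ≃ F H′) →
              ∀ {H} → UpTo≃ C H → UpTo≃ C (F H)
  upTo≃-map F closed F-≃ (H₀ , c , φ) = F H₀ , closed c , F-≃ φ

  upTo≃-map₂ : (F : LGraph k → LGraph k → LGraph k) → (∀ {G J} → C G → C J → C (F G J)) →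
               (∀ {G G′ J J′} → G ≃ G′ → J ≃ J′ → F G J ≃ F G′ J′) →
               ∀ {G J} → UpTo≃ C G → UpTo≃ C J → UpTo≃ C (F G J)
  upTo≃-map₂ F closed F-≃ (G₀ , c , φ) (J₀ , d , ψ) = F G₀ J₀ , closed c d , F-≃ φ ψ

  upTo≃-has : ∀ {H} G → UpTo≃ C H → underlying H ≅ G → Has C G
  upTo≃-has G (H₀ , c , φ) (e , p) = H₀ , c , ↔-trans (bij φ) e , λ u v → trans (p _ _) (adj-pres (embedding φ) u v)

allPairs : ∀ k → List (Fin k × Fin k)
allPairs k = cartesianProduct (allFin k) (allFin k)

module _ {k : ℕ} (R : Fin k → Fin k → Bool) where
  joins : Fin k → Fin k → Fin k × Fin k → Bool
  joins l l′ (a , b) = R a b ∧ isPair a b l l′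

  -- the edges added by applying η a b for every listed pair (a , b) on which R holds
  alongPairs : List (Fin k × Fin k) → Fin k → Fin k → Bool
  alongPairs ps l l′ = any (joins l l′) ps

  alongPairs-all : (∀ a b → R a b ≡ R b a) → ∀ l l′ → alongPairs (allPairs k) l l′ ≡ R l l′
  alongPairs-all R-sym l l′ = T-ext sound complete
    where
    sound : T (alongPairs (allPairs k) l l′) → T (R l l′)
    sound t with satisfied (any⁻ (joins l l′) (allPairs k) t)
    ... | (a , b) , t′ with Equivalence.to (T-∧ {R a b} {isPair a b l l′}) t′
    ...   | r , p with isPair-sound {a = a} {b} {l} {l′} p
    ...     | inj₁ (refl , refl) = r
    ...     | inj₂ (refl , refl) = subst T (R-sym a b) r
    complete : T (R l l′) → T (alongPairs (allPairs k) l l′)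
    complete r = any⁺ (joins l l′) (lose (∈-cartesianProduct⁺ (∈-allFin l) (∈-allFin l′))
                                            (Equivalence.from (T-∧ {R l l′} {isPair l l′ l l′}) (r , isPair-self l l′)))

  cw≃-alongPairs : (∀ a → R a a ≡ false) → ∀ ps {H} → UpTo≃ (CW k) H → UpTo≃ (CW k) (ηRel (alongPairs ps) H)
  cw≃-alongPairs R-irrefl [] {H} c = upTo≃-≃ c (≃-pointwise (λ u v → ∨-identityʳ (ladj H u v)) (λ _ → refl))
  cw≃-alongPairs R-irrefl ((a , b) ∷ ps) {H} c with R a b in Rab
  ... | false = cw≃-alongPairs R-irrefl ps c
  ... | true  = upTo≃-≃ (upTo≃-map (η a b) (cw-edges a b a≢b) (≃-ηRel (isPair a b)) (cw≃-alongPairs R-irrefl ps c))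
                        (≃-pointwise (λ u v → ∨-rotate (ladj H u v) _ _) (λ _ → refl))
    where
    a≢b : a ≢ b
    a≢b refl = case trans (sym Rab) (R-irrefl a) of λ ()
    ∨-rotate : ∀ x y z → x ∨ (z ∨ y) ≡ (x ∨ y) ∨ z
    ∨-rotate x y z = trans (cong (x ∨_) (∨-comm z y)) (sym (∨-assoc x y z))

cw≃-ηRel : ∀ {k} (R : Fin k → Fin k → Bool) → (∀ a b → R a b ≡ R b a) → (∀ a → R a a ≡ false) →
           ∀ {H} → UpTo≃ (CW k) H → UpTo≃ (CW k) (ηRel R H)
cw≃-ηRel {k} R R-sym R-irrefl {H} c =
  upTo≃-≃ (cw≃-alongPairs R R-irrefl (allPairs k) c) (≃-ηRel-rel H (alongPairs-all R R-sym))

-- A chain of isomorphisms; being a record, it lets Agda infer the intermediate graphs,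
-- which it cannot recover from the unfolded Σ-type of _≅_.
record ≅-Chain (G H : Graph) : Set where
  constructor chain
  field chained : G ≅ H

infix  1 begin≅_
infixr 2 _≅⟨_⟩_
infix  3 _≅∎

begin≅_ : ∀ {G H} → ≅-Chain G H → G ≅ H
begin≅ chain e = e

_≅⟨_⟩_ : ∀ G₁ {G₂ G₃} → G₁ ≅ G₂ → ≅-Chain G₂ G₃ → ≅-Chain G₁ G₃
_ ≅⟨ e₁ , p₁ ⟩ chain (e₂ , p₂) = chain (↔-trans e₁ e₂ , λ u v → trans (p₂ _ _) (p₁ u v))

_≅∎ : ∀ G → ≅-Chain G G
G ≅∎ = chain (↔-refl , λ _ _ → refl)

≅-sym : ∀ {G G′} → G ≅ G′ → G′ ≅ G
≅-sym {G} {G′} (e , p) =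
  ↔-sym e , λ u v → trans (sym (p _ _)) (cong₂ (adj G′) (strictlyInverseˡ e u) (strictlyInverseˡ e v))

addVertex : (G : Graph) → (Fin (n G) → Bool) → Graph
addVertex G N = mkGraph (suc (n G)) A
  where
  A : Fin (suc (n G)) → Fin (suc (n G)) → Bool
  A zero    zero    = false
  A zero    (suc v) = N v
  A (suc u) zero    = N u
  A (suc u) (suc v) = adj G u v

addVertex-cong : ∀ {G G′ N N′} → (e : G ≅ G′) → (∀ u → N′ (to (proj₁ e) u) ≡ N u) →
                 addVertex G N ≅ addVertex G′ N′
addVertex-cong (e , p) N′∘e≗N = lift₀ e , λ where
  zero    zero    → refl
  zero    (suc v) → N′∘e≗N v
  (suc u) zero    → N′∘e≗N u
  (suc u) (suc v) → p u v

joinWith-single≅addVertex : ∀ {k} (S : Fin k → Fin k → Bool) (a : Fin k) (K : LGraph k) →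
                            underlying (joinWith S (single a) K) ≅ addVertex (underlying K) (λ v → S a (lab K v))
joinWith-single≅addVertex S a K = ↔-refl , λ where
  zero    zero    → refl
  zero    (suc v) → refl
  (suc u) zero    → refl
  (suc u) (suc v) → refl

withPair : (G : Graph) → Fin (n G) → Fin (n G) → Bool → Graph
withPair G x y f = mkGraph (n G) λ u v → if isPair x y u v then f else adj G u v

if-false-else : ∀ c L → (if c then false else L) ≡ L ∧ not c
if-false-else true  L = sym (∧-zeroʳ L)
if-false-else false L = sym (∧-identityʳ L)

subdivide≅addVertex : ∀ G x y → subdivide G x y ≅ addVertex (withPair G x y false) (λ v → (v == x) ∨ (v == y))
subdivide≅addVertex G x y = ↔-refl , λ where
  zero    zero    → refl
  zero    (suc v) → refl
  (suc u) zero    → refl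
  (suc u) (suc v) → if-false-else (isPair x y u v) (adj G u v)

withPair-restore : ∀ G → IsSimple G → ∀ {x y} → adj G x y ≡ true → withPair (withPair G x y false) x y true ≅ G
withPair-restore G simple {x} {y} xy = ↔-refl , λ u v → restore u v (isPair x y u v) refl
  where
  restore : ∀ u v c → isPair x y u v ≡ c → adj G u v ≡ (if c then true else (if c then false else adj G u v))
  restore u v false _ = refl
  restore u v true  p with isPair-sound {a = x} {y} {u} {v} (subst T (sym p) tt)
  ... | inj₁ (refl , refl) = xy
  ... | inj₂ (refl , refl) = trans (IsSimple.sym simple _ _) xy

-- Deleting a vertex

record Deletion {k} (H : LGraph k) (z : Fin (size H)) (H′ : LGraph k) : Set where
  field
    embed      : Fin (suc (size H′)) ↔ Fin (size H)
    embed-zero : to embed zero ≡ z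
    embed-rest : IsEmbedding H′ H (to embed ∘ suc)
open Deletion

Deletable : ∀ {k} → (LGraph k → Set) → (H : LGraph k) → Fin (size H) → Set
Deletable C H z = (∀ w → w ≡ z) ⊎ ∃[ H′ ] (C H′ × Deletion H z H′)

module _ {k : ℕ} where
  deletion-≃ : ∀ {H K H′ : LGraph k} {z z′} →
               Deletion H z H′ → (φ : H ≃ K) → to (bij φ) z ≡ z′ → Deletion K z′ H′
  deletion-≃ d φ φz = record
    { embed      = ↔-trans (embed d) (bij φ)
    ; embed-zero = trans (cong (to (bij φ)) (embed-zero d)) φz
    ; embed-rest = embedding-∘ (embed-rest d) (embedding φ)
    }

  deletion-relabelBy : ∀ (R : Fin k → Fin k) {H H′ z} → Deletion H z H′ → Deletion (relabelBy R H) z (relabelBy R H′)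
  deletion-relabelBy R d = record { embed = embed d ; embed-zero = embed-zero d ; embed-rest = embedding-relabelBy R (embed-rest d) }

  deletion-ηRel : ∀ (R : Fin k → Fin k → Bool) {H H′ z} → Deletion H z H′ → Deletion (ηRel R H) z (ηRel R H′)
  deletion-ηRel R d = record { embed = embed d ; embed-zero = embed-zero d ; embed-rest = embedding-ηRel R (embed-rest d) }

  module _ (S : Fin k → Fin k → Bool) where
    deletion-joinWithˡ : ∀ {G G′ J u} → Deletion G u G′ → Deletion (joinWith S G J) (u ↑ˡ size J) (joinWith S G′ J)
    deletion-joinWithˡ {G} {G′} {J} d = record
      { embed      = +-cong-↔ (embed d) ↔-refl
      ; embed-zero = cong (_↑ˡ size J) (embed-zero d)
      ; embed-rest = embedding-cong shift (embedding-joinWith S (embed-rest d) embedding-id)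
      }
      where
      embedding-id : IsEmbedding J J (λ v → v)
      embedding-id = record { adj-pres = λ _ _ → refl ; lab-pres = λ _ → refl }
      e = to (embed d)
      shift : ∀ w → +-map (e ∘ suc) (λ v → v) w ≡ +-map e (λ v → v) (suc w)
      shift w with split (size G′) (size J) w
      ... | ↑ˡ-split u = trans (+-map-↑ˡ (e ∘ suc) (λ v → v) u) (sym (+-map-↑ˡ e (λ v → v) (suc u)))
      ... | ↑ʳ-split v = trans (+-map-↑ʳ (e ∘ suc) (λ v → v) v) (sym (+-map-↑ʳ e (λ v → v) v))

    deletion-joinWithˡ-only : ∀ {G J u} → (∀ w → w ≡ u) → Deletion (joinWith S G J) (u ↑ˡ size J) J
    deletion-joinWithˡ-only {G} {J} {u} only = record
      { embed      = +-cong-↔ unique ↔-refl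
      ; embed-zero = refl
      ; embed-rest = embedding-joinWithʳ S G J
      }
      where
      unique : Fin 1 ↔ Fin (size G)
      unique = mk↔ₛ′ (λ _ → u) (λ _ → zero) (λ w → sym (only w)) (λ { zero → refl })

  module _ (S : Fin k → Fin k → Bool) {G J : LGraph k} where
    private
      swap-↑ˡ : ∀ v → to (bij (joinWith-swap (flip S) J G)) (v ↑ˡ size G) ≡ size G ↑ʳ v
      swap-↑ˡ = +-comm-↑ˡ (size J) (size G)

    deletion-joinWithʳ : ∀ {J′ v} → Deletion J v J′ → Deletion (joinWith S G J) (size G ↑ʳ v) (joinWith (flip S) J′ G)
    deletion-joinWithʳ {v = v} d = deletion-≃ (deletion-joinWithˡ (flip S) d) (joinWith-swap (flip S) J G) (swap-↑ˡ v)

    deletion-joinWithʳ-only : ∀ {v} → (∀ w → w ≡ v) → Deletion (joinWith S G J) (size G ↑ʳ v) G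
    deletion-joinWithʳ-only {v} only = deletion-≃ (deletion-joinWithˡ-only (flip S) only) (joinWith-swap (flip S) J G) (swap-↑ˡ v)

  deletable-joinWith : ∀ {C : LGraph k → Set} (S : Fin k → Fin k → Bool) →
                       (∀ {G J} → C G → C J → C (joinWith S G J)) →
                       (∀ {G J} → C G → C J → C (joinWith (flip S) G J)) →
                       ∀ {G J} → C G → C J → (∀ u → Deletable C G u) → (∀ v → Deletable C J v) →
                       ∀ z → Deletable C (joinWith S G J) z
  deletable-joinWith S join join-flip {G} {J} cG cJ delG delJ z with split (size G) (size J) z
  ... | ↑ˡ-split u with delG u
  ...   | inj₁ only             = inj₂ (J , cJ , deletion-joinWithˡ-only S only)
  ...   | inj₂ (G′ , cG′ , d)   = inj₂ (joinWith S G′ J , join cG′ cJ , deletion-joinWithˡ S d)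
  deletable-joinWith S join join-flip {G} {J} cG cJ delG delJ z | ↑ʳ-split v with delJ v
  ...   | inj₁ only             = inj₂ (G , cG , deletion-joinWithʳ-only S only)
  ...   | inj₂ (J′ , cJ′ , d)   = inj₂ (joinWith (flip S) J′ G , join-flip cJ′ cG , deletion-joinWithʳ S d)

deleteNLC : ∀ {k H} → NLC k H → ∀ z → Deletable (NLC k) H z
deleteNLC (nlc-single a) zero = inj₁ λ { zero → refl }
deleteNLC (nlc-join S dG dJ) = deletable-joinWith S (nlc-join S) (nlc-join (flip S)) dG dJ (deleteNLC dG) (deleteNLC dJ)
deleteNLC (nlc-relabel R dG) z with deleteNLC dG z
... | inj₁ only           = inj₁ only
... | inj₂ (G′ , dG′ , d) = inj₂ (relabelBy R G′ , nlc-relabel R dG′ , deletion-relabelBy R d)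

deleteCW : ∀ {k H} → CW k H → ∀ z → Deletable (CW k) H z
deleteCW (cw-single a) zero = inj₁ λ { zero → refl }
deleteCW (cw-union dG dJ) = deletable-joinWith _ cw-union cw-union dG dJ (deleteCW dG) (deleteCW dJ)
deleteCW (cw-relabel a b a≢b dG) z with deleteCW dG z
... | inj₁ only           = inj₁ only
... | inj₂ (G′ , dG′ , d) = inj₂ (ρ a b G′ , cw-relabel a b a≢b dG′ , deletion-relabelBy (ρ-map a b) d)
deleteCW (cw-edges a b a≢b dG) z with deleteCW dG z
... | inj₁ only           = inj₁ only
... | inj₂ (G′ , dG′ , d) = inj₂ (η a b G′ , cw-edges a b a≢b dG′ , deletion-ηRel (isPair a b) d)

deletion-apex : ∀ {k} {H H′ : LGraph k} {z} G N → Deletion H z H′ → (φ : underlying H ≅ addVertex G N) →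
                to (proj₁ φ) z ≡ zero → underlying H′ ≅ G
deletion-apex {H = H} {H′} G N d (φ , φ-adj) φz = π , π-adj
  where
  ψ = ↔-trans (embed d) φ
  π = remove zero ψ
  suc-π : ∀ u → suc (to π u) ≡ to ψ (suc u)
  suc-π u = sym (trans (punchIn-permute ψ zero u) (cong (λ w → punchIn w (to π u)) (trans (cong (to φ) (embed-zero d)) φz)))
  π-adj : ∀ u v → adj G (to π u) (to π v) ≡ ladj H′ u v
  π-adj u v = begin
    adj (addVertex G N) (suc (to π u)) (suc (to π v))    ≡⟨ cong₂ (adj (addVertex G N)) (suc-π u) (suc-π v) ⟩
    adj (addVertex G N) (to ψ (suc u)) (to ψ (suc v))    ≡⟨ φ-adj _ _ ⟩
    ladj H (to (embed d) (suc u)) (to (embed d) (suc v)) ≡⟨ adj-pres (embed-rest d) u v ⟩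
    ladj H′ u v                                          ∎
    where open ≡-Reasoning

unsubdivide : ∀ {k} {C : LGraph k → Set} → (∀ {H} → C H → ∀ z → Deletable C H z) →
              ∀ {G x y} → Has C (subdivide G x y) → Has C (withPair G x y false)
unsubdivide delete {G} {x} {y} (H , c , φ) with delete c (from (proj₁ φ) zero)
... | inj₁ only = case trans (sym (strictlyInverseˡ (proj₁ φ) (suc x)))
                             (trans (cong (to (proj₁ φ)) (only _)) (strictlyInverseˡ (proj₁ φ) zero)) of λ ()
... | inj₂ (H′ , c′ , d) = H′ , c′ , deletion-apex (withPair G x y false) _ d
      (begin≅ underlying H                  ≅⟨ φ ⟩
              subdivide G x y               ≅⟨ subdivide≅addVertex G x y ⟩
              addVertex (withPair G x y false) _ ≅∎)
      (strictlyInverseˡ (proj₁ φ) zero)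

-- Tracking the ends of the edge

data Role : Set where
  xEnd yEnd inner : Role

crosses : Role → Role → Bool
crosses xEnd yEnd = true
crosses yEnd xEnd = true
crosses _    _    = false

crosses-irrefl : ∀ r → crosses r r ≡ false
crosses-irrefl xEnd  = refl
crosses-irrefl yEnd  = refl
crosses-irrefl inner = refl

crosses-sym : ∀ r r′ → crosses r r′ ≡ crosses r′ r
crosses-sym xEnd  xEnd  = refl
crosses-sym xEnd  yEnd  = refl
crosses-sym xEnd  inner = refl
crosses-sym yEnd  xEnd  = refl
crosses-sym yEnd  yEnd  = refl
crosses-sym yEnd  inner = refl
crosses-sym inner xEnd  = refl
crosses-sym inner yEnd  = refl
crosses-sym inner inner = refl

code : ∀ {k} → Role → Fin k → Fin (2 + k)
code xEnd  _ = zero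
code yEnd  _ = suc zero
code inner c = suc (suc c)

labelRole : ∀ {k} → Fin (2 + k) → Role
labelRole zero          = xEnd
labelRole (suc zero)    = yEnd
labelRole (suc (suc _)) = inner

labelRole-code : ∀ {k} r (c : Fin k) → labelRole (code r c) ≡ r
labelRole-code xEnd  _ = refl
labelRole-code yEnd  _ = refl
labelRole-code inner _ = refl

liftLabels : ∀ {k} → (Fin k → Fin k) → Fin (2 + k) → Fin (2 + k)
liftLabels R zero          = zero
liftLabels R (suc zero)    = suc zero
liftLabels R (suc (suc c)) = suc (suc (R c))

liftLabels-code : ∀ {k} (R : Fin k → Fin k) r c → liftLabels R (code r c) ≡ code r (R c)
liftLabels-code R xEnd  _ = refl
liftLabels-code R yEnd  _ = refl
liftLabels-code R inner _ = refl

-- lx and ly are the original labels of x and y, if these vertices are present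
decode : ∀ {k} → Maybe (Fin k) → Maybe (Fin k) → Fin (2 + k) → Maybe (Fin k)
decode lx ly zero          = lx
decode lx ly (suc zero)    = ly
decode lx ly (suc (suc c)) = just c

lift₂ : ∀ {k} → (Fin k → Fin k → Bool) → Maybe (Fin k) → Maybe (Fin k) → Bool
lift₂ S (just c) (just c′) = S c c′
lift₂ S _        _         = false

lift₂-sym : ∀ {k} {S : Fin k → Fin k → Bool} → (∀ c c′ → S c c′ ≡ S c′ c) →
            ∀ m m′ → lift₂ S m m′ ≡ lift₂ S m′ m
lift₂-sym S-sym (just c) (just c′) = S-sym c c′
lift₂-sym S-sym (just c) nothing   = refl
lift₂-sym S-sym nothing  (just c′) = refl
lift₂-sym S-sym nothing  nothing   = refl

lift₂-irrefl : ∀ {k} {S : Fin k → Fin k → Bool} → (∀ c → S c c ≡ false) → ∀ m → lift₂ S m m ≡ false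
lift₂-irrefl S-irrefl (just c) = S-irrefl c
lift₂-irrefl S-irrefl nothing  = refl

-- the label relation that simulates S on the tracked labels and sets the x–y adjacency to f
trackRel : ∀ {k} → Bool → (Fin k → Fin k → Bool) → Maybe (Fin k) → Maybe (Fin k) → Fin (2 + k) → Fin (2 + k) → Bool
trackRel f S lx ly l l′ = if crosses (labelRole l) (labelRole l′) then f else lift₂ S (decode lx ly l) (decode lx ly l′)

module _ {k : ℕ} (f : Bool) (S : Fin k → Fin k → Bool) {lx ly : Maybe (Fin k)} where
  trackRel-code : ∀ r r′ {c c′} → decode lx ly (code r c) ≡ just c → decode lx ly (code r′ c′) ≡ just c′ →
                  trackRel f S lx ly (code r c) (code r′ c′) ≡ (if crosses r r′ then f else S c c′)
  trackRel-code r r′ {c} {c′} dc dc′ rewrite labelRole-code r c | labelRole-code r′ c′ | dc | dc′ = refl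

  trackRel-sym : (∀ c c′ → S c c′ ≡ S c′ c) → ∀ l l′ → trackRel f S lx ly l l′ ≡ trackRel f S lx ly l′ l
  trackRel-sym S-sym l l′ =
    cong₂ (if_then f else_) (crosses-sym (labelRole l) (labelRole l′)) (lift₂-sym S-sym (decode lx ly l) (decode lx ly l′))

  trackRel-irrefl : (∀ c → S c c ≡ false) → ∀ l → trackRel f S lx ly l l ≡ false
  trackRel-irrefl S-irrefl l rewrite crosses-irrefl (labelRole l) = lift₂-irrefl S-irrefl (decode lx ly l)

trackRel-empty : ∀ {k} (lx ly : Maybe (Fin k)) l l′ → trackRel false (λ _ _ → false) lx ly l l′ ≡ false
trackRel-empty lx ly l l′ =
  trans (cong (if crosses (labelRole l) (labelRole l′) then false else_) (no-edges (decode lx ly l) (decode lx ly l′)))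
        (if-eta (crosses (labelRole l) (labelRole l′)))
  where
  no-edges : ∀ m m′ → lift₂ (λ _ _ → false) m m′ ≡ false
  no-edges (just _) (just _) = refl
  no-edges (just _) nothing  = refl
  no-edges nothing  _        = refl

Track : ∀ {k} (H : LGraph k) → (Fin (size H) → Role) → Bool → LGraph (2 + k)
Track H ρ f = mkLGraph (size H) (λ u v → if crosses (ρ u) (ρ v) then f else ladj H u v) (λ u → code (ρ u) (lab H u))

Decodes : ∀ {k} → Maybe (Fin k) → Maybe (Fin k) → (H : LGraph k) → (Fin (size H) → Role) → Set
Decodes lx ly H ρ = ∀ u → decode lx ly (code (ρ u) (lab H u)) ≡ just (lab H u)

module _ {k : ℕ} (f : Bool) where
  Track-single : ∀ (a : Fin k) ρ → Track (single a) ρ f ≃ single (code (ρ zero) a)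
  Track-single a ρ = ≃-pointwise no-loop (λ { zero → refl })
    where
    no-loop : ∀ u v → false ≡ (if crosses (ρ u) (ρ v) then f else false)
    no-loop zero zero rewrite crosses-irrefl (ρ zero) = refl

  Track-role-cong : ∀ {H : LGraph k} {ρ ρ′} → (∀ u → ρ u ≡ ρ′ u) → Track H ρ f ≃ Track H ρ′ f
  Track-role-cong {H} ρ≗ρ′ = ≃-pointwise
    (λ u v → cong₂ (λ r r′ → if crosses r r′ then f else ladj H u v) (sym (ρ≗ρ′ u)) (sym (ρ≗ρ′ v)))
    (λ u → cong (λ r → code r (lab H u)) (sym (ρ≗ρ′ u)))

  Track-joinWith : ∀ S (G J : LGraph k) ρ {lx ly} → Decodes lx ly (joinWith S G J) ρ →
                   Track (joinWith S G J) ρ f ≃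
                   joinWith (trackRel f S lx ly) (Track G (ρ ∘ (_↑ˡ size J)) f) (Track J (ρ ∘ (size G ↑ʳ_)) f)
  Track-joinWith S G J ρ {lx} {ly} dec = ≃-pointwise adjs labs
    where
    g = size G
    j = size J
    S′ = trackRel f S lx ly
    TG = Track G (ρ ∘ (_↑ˡ j)) f
    TJ = Track J (ρ ∘ (g ↑ʳ_)) f
    decˡ : ∀ u → decode lx ly (code (ρ (u ↑ˡ j)) (lab G u)) ≡ just (lab G u)
    decˡ u = subst (λ c → decode lx ly (code (ρ (u ↑ˡ j)) c) ≡ just c) (joinWith-labˡ S G J u) (dec (u ↑ˡ j))
    decʳ : ∀ v → decode lx ly (code (ρ (g ↑ʳ v)) (lab J v)) ≡ just (lab J v)
    decʳ v = subst (λ c → decode lx ly (code (ρ (g ↑ʳ v)) c) ≡ just c) (joinWith-labʳ S G J v) (dec (g ↑ʳ v))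
    adjs : ∀ w w′ → ladj (joinWith S′ TG TJ) w w′ ≡ ladj (Track (joinWith S G J) ρ f) w w′
    adjs w w′ with split g j w | split g j w′
    ... | ↑ˡ-split u | ↑ˡ-split u′ rewrite joinWith-adjˡˡ S′ TG TJ u u′ | joinWith-adjˡˡ S G J u u′ = refl
    ... | ↑ˡ-split u | ↑ʳ-split v′ rewrite joinWith-adjˡʳ S′ TG TJ u v′ | joinWith-adjˡʳ S G J u v′ =
      trackRel-code f S (ρ (u ↑ˡ j)) (ρ (g ↑ʳ v′)) (decˡ u) (decʳ v′)
    ... | ↑ʳ-split v | ↑ˡ-split u′ rewrite joinWith-adjʳˡ S′ TG TJ v u′ | joinWith-adjʳˡ S G J v u′ =
      trans (trackRel-code f S (ρ (u′ ↑ˡ j)) (ρ (g ↑ʳ v)) (decˡ u′) (decʳ v))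
            (cong (if_then f else S (lab G u′) (lab J v)) (crosses-sym (ρ (u′ ↑ˡ j)) (ρ (g ↑ʳ v))))
    ... | ↑ʳ-split v | ↑ʳ-split v′ rewrite joinWith-adjʳʳ S′ TG TJ v v′ | joinWith-adjʳʳ S G J v v′ = refl
    labs : ∀ w → lab (joinWith S′ TG TJ) w ≡ code (ρ w) (lab (joinWith S G J) w)
    labs w with split g j w
    ... | ↑ˡ-split u rewrite joinWith-labˡ S′ TG TJ u | joinWith-labˡ S G J u = refl
    ... | ↑ʳ-split v rewrite joinWith-labʳ S′ TG TJ v | joinWith-labʳ S G J v = refl

  Track-relabelBy : ∀ (R : Fin k → Fin k) (R′ : Fin (2 + k) → Fin (2 + k)) → (∀ r c → R′ (code r c) ≡ code r (R c)) →
                    ∀ (G : LGraph k) ρ → Track (relabelBy R G) ρ f ≃ relabelBy R′ (Track G ρ f)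
  Track-relabelBy R R′ R′∘code G ρ = ≃-pointwise (λ _ _ → refl) (λ u → R′∘code (ρ u) (lab G u))

  Track-ηRel : ∀ R (G : LGraph k) ρ {lx ly} → Decodes lx ly G ρ →
               Track (ηRel R G) ρ f ≃ ηRel (trackRel f R lx ly) (Track G ρ f)
  Track-ηRel R G ρ {lx} {ly} dec = ≃-pointwise adjs (λ _ → refl)
    where
    if-∨ : ∀ c x y → (if c then f else x) ∨ (if c then f else y) ≡ (if c then f else (x ∨ y))
    if-∨ true  _ _ = ∨-idem f
    if-∨ false _ _ = refl
    adjs : ∀ u v → ladj (ηRel (trackRel f R lx ly) (Track G ρ f)) u v ≡ ladj (Track (ηRel R G) ρ f) u v
    adjs u v rewrite trackRel-code f R (ρ u) (ρ v) (dec u) (dec v) = if-∨ (crosses (ρ u) (ρ v)) _ _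

roleOf : Bool → Bool → Role
roleOf true  _     = xEnd
roleOf false true  = yEnd
roleOf false false = inner

marks : ∀ {m} → Maybe (Fin m) → Fin m → Bool
marks nothing  _ = false
marks (just w) u = u == w

role : ∀ {m} → Maybe (Fin m) → Maybe (Fin m) → Fin m → Role
role mx my u = roleOf (marks mx u) (marks my u)

marks-just : ∀ {m} (mx : Maybe (Fin m)) {u} → marks mx u ≡ true → mx ≡ just u
marks-just (just w) u≡w = cong just (sym (==⇒≡ u≡w))

decodes-role : ∀ {k} (H : LGraph k) mx my → Decodes (mapₘ (lab H) mx) (mapₘ (lab H) my) H (role mx my)
decodes-role H mx my u with marks mx u in x-marks | marks my u in y-marks
... | true  | _     = cong (mapₘ (lab H)) (marks-just mx x-marks)
... | false | true  = cong (mapₘ (lab H)) (marks-just my y-marks)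
... | false | false = refl

restrictˡ : ∀ m {n} → Maybe (Fin (m + n)) → Maybe (Fin m)
restrictˡ m mx = mx >>= λ w → isInj₁ (splitAt m w)

restrictʳ : ∀ m {n} → Maybe (Fin (m + n)) → Maybe (Fin n)
restrictʳ m mx = mx >>= λ w → isInj₂ (splitAt m w)

module _ (m n : ℕ) where
  marks-↑ˡ : ∀ (mx : Maybe (Fin (m + n))) u → marks mx (u ↑ˡ n) ≡ marks (restrictˡ m mx) u
  marks-↑ˡ nothing  u = refl
  marks-↑ˡ (just w) u with split m n w
  ... | ↑ˡ-split u′ rewrite splitAt-↑ˡ m u′ n = ==-injective (_↑ˡ n) (↑ˡ-injective n _ _) u u′
  ... | ↑ʳ-split v  rewrite splitAt-↑ʳ m n v  = ==-≢ (↑ˡ≢↑ʳ m n u v)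

  marks-↑ʳ : ∀ (mx : Maybe (Fin (m + n))) v → marks mx (m ↑ʳ v) ≡ marks (restrictʳ m mx) v
  marks-↑ʳ nothing  v = refl
  marks-↑ʳ (just w) v with split m n w
  ... | ↑ˡ-split u  rewrite splitAt-↑ˡ m u n  = ==-≢ (↑ˡ≢↑ʳ m n u v ∘ sym)
  ... | ↑ʳ-split v′ rewrite splitAt-↑ʳ m n v′ = ==-injective (m ↑ʳ_) (↑ʳ-injective m _ _) v v′

  role-↑ˡ : ∀ mx my u → role mx my (u ↑ˡ n) ≡ role (restrictˡ m mx) (restrictˡ m my) u
  role-↑ˡ mx my u = cong₂ roleOf (marks-↑ˡ mx u) (marks-↑ˡ my u)

  role-↑ʳ : ∀ mx my v → role mx my (m ↑ʳ v) ≡ role (restrictʳ m mx) (restrictʳ m my) v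
  role-↑ʳ mx my v = cong₂ roleOf (marks-↑ʳ mx v) (marks-↑ʳ my v)

trackNLC : ∀ {k H} → NLC k H → ∀ mx my f → UpTo≃ (NLC (2 + k)) (Track H (role mx my) f)
trackNLC (nlc-single a) mx my f = upTo≃-≃ (upTo≃-of (nlc-single _)) (≃-sym (Track-single f a (role mx my)))
trackNLC {k} (nlc-join {G} {J} S dG dJ) mx my f =
  upTo≃-≃ (upTo≃-map₂ (joinWith S′) (nlc-join S′) (≃-joinWith S′) trackG trackJ)
          (≃-sym (Track-joinWith f S G J (role mx my) (decodes-role (joinWith S G J) mx my)))
  where
  g = size G
  j = size J
  S′ = trackRel f S (mapₘ (lab (joinWith S G J)) mx) (mapₘ (lab (joinWith S G J)) my)
  trackG : UpTo≃ (NLC (2 + k)) (Track G (role mx my ∘ (_↑ˡ j)) f)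
  trackG = upTo≃-≃ (trackNLC dG (restrictˡ g mx) (restrictˡ g my) f) (Track-role-cong f (sym ∘ role-↑ˡ g j mx my))
  trackJ : UpTo≃ (NLC (2 + k)) (Track J (role mx my ∘ (g ↑ʳ_)) f)
  trackJ = upTo≃-≃ (trackNLC dJ (restrictʳ g mx) (restrictʳ g my) f) (Track-role-cong f (sym ∘ role-↑ʳ g j mx my))
trackNLC (nlc-relabel {G} R dG) mx my f =
  upTo≃-≃ (upTo≃-map (relabelBy (liftLabels R)) (nlc-relabel (liftLabels R)) (≃-relabelBy (liftLabels R)) (trackNLC dG mx my f))
          (≃-sym (Track-relabelBy f R (liftLabels R) (liftLabels-code R) G (role mx my)))

ρ-map-code : ∀ {k} (a b : Fin k) r c → ρ-map (suc (suc a)) (suc (suc b)) (code r c) ≡ code r (ρ-map a b c)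
ρ-map-code a b xEnd  c = refl
ρ-map-code a b yEnd  c = refl
ρ-map-code a b inner c with c ≟ a
... | yes _ = refl
... | no _  = refl

trackCW : ∀ {k H} → CW k H → ∀ mx my → UpTo≃ (CW (2 + k)) (Track H (role mx my) false)
trackCW (cw-single a) mx my = upTo≃-≃ (upTo≃-of (cw-single _)) (≃-sym (Track-single false a (role mx my)))
trackCW {k} (cw-union {G} {J} dG dJ) mx my =
  upTo≃-≃ (upTo≃-map₂ _⊕_ cw-union (≃-joinWith _) trackG trackJ)
          (≃-sym (≃-trans (Track-joinWith false (λ _ _ → false) G J (role mx my) (decodes-role (G ⊕ J) mx my))
                          (≃-joinWith-rel (Track G (role mx my ∘ (_↑ˡ j)) false) (Track J (role mx my ∘ (g ↑ʳ_)) false)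
                                          (trackRel-empty _ _))))
  where
  g = size G
  j = size J
  trackG : UpTo≃ (CW (2 + k)) (Track G (role mx my ∘ (_↑ˡ j)) false)
  trackG = upTo≃-≃ (trackCW dG (restrictˡ g mx) (restrictˡ g my)) (Track-role-cong false (sym ∘ role-↑ˡ g j mx my))
  trackJ : UpTo≃ (CW (2 + k)) (Track J (role mx my ∘ (g ↑ʳ_)) false)
  trackJ = upTo≃-≃ (trackCW dJ (restrictʳ g mx) (restrictʳ g my)) (Track-role-cong false (sym ∘ role-↑ʳ g j mx my))
trackCW (cw-relabel {G} a b a≢b dG) mx my =
  upTo≃-≃ (upTo≃-map (ρ (suc (suc a)) (suc (suc b))) (cw-relabel _ _ (a≢b ∘ suc-injective ∘ suc-injective))
                      (≃-relabelBy (ρ-map (suc (suc a)) (suc (suc b)))) (trackCW dG mx my))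
          (≃-sym (Track-relabelBy false (ρ-map a b) (ρ-map (suc (suc a)) (suc (suc b))) (ρ-map-code a b) G (role mx my)))
trackCW (cw-edges {G} a b a≢b dG) mx my =
  upTo≃-≃ (cw≃-ηRel R′ (trackRel-sym false (isPair a b) (isPair-sym a b))
                       (trackRel-irrefl false (isPair a b) (isPair-irrefl a≢b))
                       (trackCW dG mx my))
          (≃-sym (Track-ηRel false (isPair a b) G (role mx my) (decodes-role G mx my)))
  where
  R′ = trackRel false (isPair a b) (mapₘ (lab G) mx) (mapₘ (lab G) my)

crosses-roleOf : ∀ a b c d → (a ≡ true → b ≡ false) → (c ≡ true → d ≡ false) →
                 crosses (roleOf a b) (roleOf c d) ≡ (a ∧ d) ∨ (b ∧ c)
crosses-roleOf true  true  _     _     a⇒¬b _    = case a⇒¬b refl of λ ()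
crosses-roleOf _     _     true  true  _    c⇒¬d = case c⇒¬d refl of λ ()
crosses-roleOf true  false true  false _    _    = refl
crosses-roleOf true  false false true  _    _    = refl
crosses-roleOf true  false false false _    _    = refl
crosses-roleOf false true  true  false _    _    = refl
crosses-roleOf false true  false true  _    _    = refl
crosses-roleOf false true  false false _    _    = refl
crosses-roleOf false false _     _     _    _    = refl

crosses-role : ∀ {m} {x y : Fin m} → x ≢ y →
               ∀ u v → crosses (role (just x) (just y) u) (role (just x) (just y) v) ≡ isPair x y u v
crosses-role {x = x} {y} x≢y u v = crosses-roleOf (u == x) (u == y) (v == x) (v == y) (exclusive u) (exclusive v)
  where
  exclusive : ∀ w → (w == x) ≡ true → (w == y) ≡ false
  exclusive w w≡x = ==-≢ (λ w≡y → x≢y (trans (sym (==⇒≡ w≡x)) w≡y))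

code-ends : ∀ {k} a b (c : Fin k) → (code (roleOf a b) c == zero) ∨ (code (roleOf a b) c == suc zero) ≡ a ∨ b
code-ends true  _     _ = refl
code-ends false true  _ = refl
code-ends false false _ = refl

rolesVia : ∀ {s m} → Fin s ↔ Fin m → Fin m → Fin m → Fin s → Role
rolesVia e x y = role (just (from e x)) (just (from e y))

endsRel : ∀ {k} → Fin (2 + k) → Fin (2 + k) → Bool
endsRel _ l = (l == zero) ∨ (l == suc zero)

module _ {k : ℕ} (H : LGraph k) (G : Graph) (e : underlying H ≅ G) {x y : Fin (n G)} (x≢y : x ≢ y) where
  private
    x′ = from (proj₁ e) x
    y′ = from (proj₁ e) y

  Track≅withPair : ∀ f → underlying (Track H (rolesVia (proj₁ e) x y) f) ≅ withPair G x y f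
  Track≅withPair f = proj₁ e , λ u v →
    cong₂ (if_then f else_) (trans (isPair-↔ (proj₁ e) x y u v) (sym (crosses-role x′≢y′ u v))) (proj₂ e u v)
    where
    x′≢y′ : x′ ≢ y′
    x′≢y′ = x≢y ∘ Injection.injective (↔⇒↣ (↔-sym (proj₁ e)))

  apex-over-Track≅subdivide : ∀ a →
    underlying (joinWith endsRel (single a) (Track H (rolesVia (proj₁ e) x y) false)) ≅ subdivide G x y
  apex-over-Track≅subdivide a =
    begin≅ underlying (joinWith endsRel (single a) K)                 ≅⟨ joinWith-single≅addVertex endsRel a K ⟩
           addVertex (underlying K) (λ v → endsRel a (lab K v))       ≅⟨ addVertex-cong (Track≅withPair false) ends ⟩
           addVertex (withPair G x y false) (λ v → (v == x) ∨ (v == y)) ≅⟨ ≅-sym (subdivide≅addVertex G x y) ⟩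
           subdivide G x y                                            ≅∎
    where
    K = Track H (rolesVia (proj₁ e) x y) false
    ends : ∀ u → (to (proj₁ e) u == x) ∨ (to (proj₁ e) u == y) ≡ endsRel a (lab K u)
    ends u = trans (cong₂ _∨_ (==-to (proj₁ e) u x) (==-to (proj₁ e) u y)) (sym (code-ends (u == x′) (u == y′) (lab H u)))

module _ {k : ℕ} {a : Fin k} where
  isPair-apexˡ : ∀ b {l} → (l == a) ≡ false → isPair a b a l ≡ (l == b)
  isPair-apexˡ b {l} l≢a rewrite ==-refl a | l≢a | ∧-zeroʳ (a == b) = ∨-identityʳ (l == b)

  isPair-apexʳ : ∀ b {l} → (l == a) ≡ false → isPair a b l a ≡ (l == b)
  isPair-apexʳ b {l} l≢a = trans (isPair-sym a b l a) (isPair-apexˡ b l≢a)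

  isPair-avoid : ∀ b {l l′} → (l == a) ≡ false → (l′ == a) ≡ false → isPair a b l l′ ≡ false
  isPair-avoid b {l} l≢a l′≢a rewrite l≢a | l′≢a = ∧-zeroʳ (l == b)

  apex-η : ∀ {b c} → a ≢ b → a ≢ c → (K : LGraph k) → (∀ v → (lab K v == a) ≡ false) →
           η a c (η a b (single a ⊕ K)) ≃ joinWith (λ _ l → (l == b) ∨ (l == c)) (single a) K
  apex-η {b} {c} a≢b a≢c K unused = ≃-pointwise adjs (λ { zero → refl ; (suc _) → refl })
    where
    adjs : ∀ w w′ → ladj (joinWith (λ _ l → (l == b) ∨ (l == c)) (single a) K) w w′ ≡
                    ladj (η a c (η a b (single a ⊕ K))) w w′
    adjs zero    zero    rewrite isPair-irrefl a≢b a | isPair-irrefl a≢c a = refl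
    adjs zero    (suc v) rewrite isPair-apexˡ b (unused v) | isPair-apexˡ c (unused v) = refl
    adjs (suc u) zero    rewrite isPair-apexʳ b (unused u) | isPair-apexʳ c (unused u) = refl
    adjs (suc u) (suc v) rewrite isPair-avoid b (unused u) (unused v) | isPair-avoid c (unused u) (unused v)
                               | ∨-identityʳ (ladj K u v) | ∨-identityʳ (ladj K u v) = refl

ρ-frees : ∀ {k} (H : LGraph k) {a b} → a ≢ b → ∀ u → (lab (ρ a b H) u == a) ≡ false
ρ-frees H {a} {b} a≢b u with lab H u ≟ a
... | yes _  = ==-≢ (a≢b ∘ sym)
... | no l≢a = ==-≢ l≢a

Track-unused : ∀ {k} (H : LGraph k) ρ f {a} → (∀ u → (lab H u == a) ≡ false) →
               ∀ u → (lab (Track H ρ f) u == code inner a) ≡ false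
Track-unused H ρ f {a} unused u with ρ u
... | xEnd  = refl
... | yEnd  = refl
... | inner = trans (==-injective (λ c → suc (suc c)) (suc-injective ∘ suc-injective) (lab H u) a) (unused u)

isPair-01-code : ∀ {k} r r′ (c c′ : Fin k) → isPair zero (suc zero) (code r c) (code r′ c′) ≡ crosses r r′
isPair-01-code xEnd  xEnd  _ _ = refl
isPair-01-code xEnd  yEnd  _ _ = refl
isPair-01-code xEnd  inner _ _ = refl
isPair-01-code yEnd  xEnd  _ _ = refl
isPair-01-code yEnd  yEnd  _ _ = refl
isPair-01-code yEnd  inner _ _ = refl
isPair-01-code inner xEnd  _ _ = refl
isPair-01-code inner yEnd  _ _ = refl
isPair-01-code inner inner _ _ = refl

η01-Track : ∀ {k} (H : LGraph k) ρ → η zero (suc zero) (Track H ρ false) ≃ Track H ρ true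
η01-Track H ρ = ≃-pointwise adjs (λ _ → refl)
  where
  link : ∀ c L → (if c then true else L) ≡ (if c then false else L) ∨ c
  link true  L = refl
  link false L = sym (∨-identityʳ L)
  adjs : ∀ u v → ladj (Track H ρ true) u v ≡ ladj (η zero (suc zero) (Track H ρ false)) u v
  adjs u v rewrite isPair-01-code (ρ u) (ρ v) (lab H u) (lab H v) = link (crosses (ρ u) (ρ v)) (ladj H u v)

¬CW0 : ∀ {H} → ¬ CW 0 H
¬CW0 (cw-single ())
¬CW0 (cw-union c _)         = ¬CW0 c
¬CW0 (cw-relabel _ _ _ c)   = ¬CW0 c
¬CW0 (cw-edges _ _ _ c)     = ¬CW0 c

CW1-edgeless : ∀ {H} → CW 1 H → ∀ u v → ladj H u v ≡ false
CW1-edgeless (cw-single _) zero zero = refl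
CW1-edgeless (cw-union {G} {J} cG cJ) w w′ with split (size G) (size J) w | split (size G) (size J) w′
... | ↑ˡ-split u | ↑ˡ-split u′ = trans (joinWith-adjˡˡ _ G J u u′) (CW1-edgeless cG u u′)
... | ↑ˡ-split u | ↑ʳ-split v′ = joinWith-adjˡʳ _ G J u v′
... | ↑ʳ-split v | ↑ˡ-split u′ = joinWith-adjʳˡ _ G J v u′
... | ↑ʳ-split v | ↑ʳ-split v′ = trans (joinWith-adjʳʳ _ G J v v′) (CW1-edgeless cJ v v′)
CW1-edgeless (cw-relabel _ _ _ c) = CW1-edgeless c
CW1-edgeless (cw-edges zero zero a≢b _) = contradiction refl a≢b

edge-ends-distinct : ∀ {G} → IsSimple G → ∀ {x y} → adj G x y ≡ true → x ≢ y
edge-ends-distinct {G} simple {x} xy refl = case trans (sym xy) (IsSimple.irrefl simple x) of λ ()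

hasCW1-edgeless : ∀ {G} → HasCW 1 G → ∀ x y → adj G x y ≡ false
hasCW1-edgeless {G} (H , h , e , p) x y = begin
  adj G x y                                 ≡⟨ cong₂ (adj G) (sym (strictlyInverseˡ e x)) (sym (strictlyInverseˡ e y)) ⟩
  adj G (to e (from e x)) (to e (from e y)) ≡⟨ p _ _ ⟩
  ladj H (from e x) (from e y)              ≡⟨ CW1-edgeless h _ _ ⟩
  false                                     ∎
  where open ≡-Reasoning

module _ {G : Graph} {x y : Fin (n G)} where
  hasNLC-subdivide : ∀ {k} → x ≢ y → HasNLC k G → HasNLC (2 + k) (subdivide G x y)
  hasNLC-subdivide {k} x≢y (H , h , e) = upTo≃-has (subdivide G x y) apexed (apex-over-Track≅subdivide H G e x≢y zero)
    where
    tracked : UpTo≃ (NLC (2 + k)) (Track H (rolesVia (proj₁ e) x y) false)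
    tracked = trackNLC h (just (from (proj₁ e) x)) (just (from (proj₁ e) y)) false
    apexed : UpTo≃ (NLC (2 + k)) (joinWith endsRel (single zero) (Track H (rolesVia (proj₁ e) x y) false))
    apexed  = upTo≃-map₂ (joinWith endsRel) (nlc-join endsRel) (≃-joinWith endsRel) (upTo≃-of (nlc-single zero)) tracked

  hasCW-subdivide : ∀ {k} → adj G x y ≡ true → x ≢ y → HasCW k G → HasCW (2 + k) (subdivide G x y)
  hasCW-subdivide {zero}        xy x≢y (H , h , e) = ⊥-elim (¬CW0 h)
  hasCW-subdivide {suc zero}    xy x≢y has = case trans (sym xy) (hasCW1-edgeless has x y) of λ ()
  hasCW-subdivide {suc (suc k)} xy x≢y (H , h , e) =
    upTo≃-has (subdivide G x y) (upTo≃-≃ apexed (apex-η (λ ()) (λ ()) K unused)) (apex-over-Track≅subdivide H′ G e x≢y ι)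
    where
    -- merging the labels 1 and 0 of H frees the label ι for the new vertex
    H′ = ρ (suc zero) zero H
    K = Track H′ (rolesVia (proj₁ e) x y) false
    ι = code inner (suc zero)
    unused : ∀ v → (lab K v == ι) ≡ false
    unused = Track-unused H′ _ false (ρ-frees H (λ ()))
    tracked : UpTo≃ (CW (4 + k)) K
    tracked = trackCW (cw-relabel _ _ (λ ()) h) (just (from (proj₁ e) x)) (just (from (proj₁ e) y))
    apexed : UpTo≃ (CW (4 + k)) (η ι (suc zero) (η ι zero (single ι ⊕ K)))
    apexed = upTo≃-map (η ι (suc zero)) (cw-edges _ _ (λ ())) (≃-ηRel (isPair ι (suc zero)))
               (upTo≃-map (η ι zero) (cw-edges _ _ (λ ())) (≃-ηRel (isPair ι zero))
                 (upTo≃-map₂ _⊕_ cw-union (≃-joinWith _) (upTo≃-of (cw-single ι)) tracked))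

  module _ (simple : IsSimple G) (xy : adj G x y ≡ true) where
    private
      x≢y : x ≢ y
      x≢y = edge-ends-distinct simple xy

      restore : ∀ {k} {H : LGraph k} (e : underlying H ≅ withPair G x y false) →
                underlying (Track H (rolesVia (proj₁ e) x y) true) ≅ G
      restore {H = H} e =
        begin≅ underlying (Track H (rolesVia (proj₁ e) x y) true) ≅⟨ Track≅withPair H (withPair G x y false) e x≢y true ⟩
               withPair (withPair G x y false) x y true           ≅⟨ withPair-restore G simple xy ⟩
               G                                                  ≅∎

    hasNLC-unsubdivide : ∀ {k} → HasNLC k (subdivide G x y) → HasNLC (2 + k) G
    hasNLC-unsubdivide has with unsubdivide deleteNLC has
    ... | H , h , e = upTo≃-has G (trackNLC h (just (from (proj₁ e) x)) (just (from (proj₁ e) y)) true) (restore {H = H} e)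

    hasCW-unsubdivide : ∀ {k} → HasCW k (subdivide G x y) → HasCW (2 + k) G
    hasCW-unsubdivide {k} has with unsubdivide deleteCW has
    ... | H , h , e = upTo≃-has G (upTo≃-≃ joined (η01-Track H (rolesVia (proj₁ e) x y))) (restore {H = H} e)
      where
      tracked : UpTo≃ (CW (2 + k)) (Track H (rolesVia (proj₁ e) x y) false)
      tracked = trackCW h (just (from (proj₁ e) x)) (just (from (proj₁ e) y))
      joined : UpTo≃ (CW (2 + k)) (η zero (suc zero) (Track H (rolesVia (proj₁ e) x y) false))
      joined  = upTo≃-map (η zero (suc zero)) (cw-edges _ _ (λ ())) (≃-ηRel (isPair zero (suc zero))) tracked

least-≤ : ∀ {P : ℕ → Set} {a m} → 0 < m → P m → (∀ k → 0 < k → k < a → ¬ P k) → a ≤ m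
least-≤ {a = a} {m} 0<m pm minimal with a ≤? m
... | yes a≤m = a≤m
... | no  a≰m = contradiction pm (minimal m 0<m (≰⇒> a≰m))

widths-within-2 : ∀ {P Q : ℕ → Set} {a b} → (∀ k → 0 < k → k < a → ¬ P k) → (∀ k → 0 < k → k < b → ¬ Q k) →
                  P (2 + b) → Q (2 + a) → (a ≤ b + 2) × (b ≤ a + 2)
widths-within-2 {a = a} {b} minP minQ p q =
  subst (a ≤_) (+-comm 2 b) (least-≤ (s≤s z≤n) p minP) , subst (b ≤_) (+-comm 2 a) (least-≤ (s≤s z≤n) q minQ)

theorem9 : (G : Graph) → IsSimple G → (x y : Fin (n G)) → adj G x y ≡ true →
           (∀ a b → IsNLCW G a → IsNLCW (subdivide G x y) b → (a ≤ b + 2) × (b ≤ a + 2)) ×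
           (∀ a b → IsCW G a → IsCW (subdivide G x y) b → (a ≤ b + 2) × (b ≤ a + 2))
theorem9 G simple x y xy =
  (λ a b (_ , hasG , minG) (_ , hasGxy , minGxy) →
     widths-within-2 minG minGxy (hasNLC-unsubdivide simple xy hasGxy) (hasNLC-subdivide x≢y hasG)) ,
  (λ a b (_ , hasG , minG) (_ , hasGxy , minGxy) →
     widths-within-2 minG minGxy (hasCW-unsubdivide simple xy hasGxy) (hasCW-subdivide xy x≢y hasG))
  where
  x≢y : x ≢ y
  x≢y = edge-ends-distinct simple xy
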